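{- Let $k\ge1$ and $d\ge1$ be integers, and let $S$ be a $k$-AP combination all of whose constituent arithmetic progressions have common differences coprime to $d$. Then the number of elements of $S$ divisible by $d$ equals $|S|/d+\theta$ for some real $\theta$ with $|\theta|\le k$.
   Context: Arithmetic progressions here are finite (possibly empty) sets of integers $\{a, a+q, \dots, a+(m-1)q\}$. For an integer $k\ge1$, a set $S$ of integers is a $k$-AP combination if it can be built by the following rules: (1) a single arithmetic progression is a $1$-AP combination; (2) if $S_1$ is a $k_1$-AP combination, $S_2$ is a $k_2$-AP combination and $S_1\cap S_2=\emptyset$, then $S_1\cup S_2$ is a $(k_1+k_2)$-AP combination; (3) if $S_1$ is a $k_1$-AP combination and $S_2\subseteq S_1$ is a $k_2$-AP combination, then $S_1\setminus S_2$ is a $(k_1+k_2)$-AP combination. The constituent arithmetic progressions of $S$ are those used in such a construction. Since empty progressions are allowed, a $k$-AP combination is also a $k'$-AP combination for every $k'>k$. -}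

module Defs where

open import Level using (0ℓ)
open import Data.Nat as ℕ using (ℕ; zero; suc)
open import Data.Nat.Divisibility as ND using (_∣?_)
open import Data.Nat.Coprimality using (Coprime)
open import Data.Integer as ℤ using (ℤ; +_; ∣_∣)
open import Data.Fin using (Fin; toℕ)
open import Data.Product using (Σ; _×_)
open import Data.Empty using (⊥)
open import Data.List using (List; filter; length)
open import Relation.Nullary using (¬_)
open import Relation.Binary.PropositionalEquality using (_≡_)

ISet : Set₁
ISet = ℤ → Set

AP : ℤ → ℤ → ℕ → ISet
AP a q m x = Σ (Fin m) λ i → x ≡ a ℤ.+ (+ toℕ i) ℤ.* q

_≐_ : ISet → ISet → Set
S ≐ T = ∀ x → (S x → T x) × (T x → S x)

_⊆_ : ISet → ISet → Set
S ⊆ T = ∀ x → S x → T x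

Disjoint : ISet → ISet → Set
Disjoint S T = ∀ x → S x → T x → ⊥

_∪_ : ISet → ISet → ISet
(S ∪ T) x = Data.Sum._⊎_ (S x) (T x)
  where import Data.Sum

_∖_ : ISet → ISet → ISet
(S ∖ T) x = S x × ¬ T x

data APComb (d : ℕ) : ℕ → ISet → Set₁ where
  ap    : ∀ {S} (a q : ℤ) (m : ℕ) → Coprime ∣ q ∣ d → S ≐ AP a q m → APComb d 1 S
  union : ∀ {S S₁ S₂ k₁ k₂} → APComb d k₁ S₁ → APComb d k₂ S₂ →
          Disjoint S₁ S₂ → S ≐ (S₁ ∪ S₂) → APComb d (k₁ ℕ.+ k₂) S
  diff  : ∀ {S S₁ S₂ k₁ k₂} → APComb d k₁ S₁ → APComb d k₂ S₂ →
          S₂ ⊆ S₁ → S ≐ (S₁ ∖ S₂) → APComb d (k₁ ℕ.+ k₂) S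

_∈L_ : ℤ → List ℤ → Set
x ∈L L = Data.List.Membership.Propositional._∈_ x L
  where import Data.List.Membership.Propositional

countDiv : ℕ → List ℤ → ℕ
countDiv d L = length (filter (λ x → d ∣? ∣ x ∣) L)

-- Write δ(L) = d·#{x ∈ L : d ∣ x} − |L| for a duplicate-free list L enumerating a set, so
-- that δ = d·θ. It depends only on the set, is additive over disjoint unions, and for S₂ ⊆ S₁
-- satisfies δ(S₁ ∖ S₂) = δ(S₁) − δ(S₂); so by induction on the construction it suffices that
-- |δ| ≤ d for one progression whose difference q is coprime to d. Any d consecutive terms of it
-- contain exactly one multiple of d: at most one because d ∣ j·q forces d ∣ j, at least one
-- because q is invertible mod d. Hence every full block of d terms contributes 0 to δ, and the
-- remaining < d terms contribute at most d.
module Submission where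

open import Defs
open import Data.Nat using (ℕ; _≤_)
open import Data.Integer using (ℤ; +_; ∣_∣; _-_; _*_)
open import Data.List using (List; length)
open import Data.List.Relation.Unary.Unique.Propositional using (Unique)

open import Data.Nat as ℕ using (zero; suc; s≤s; z≤n; NonZero; NonTrivial)
import Data.Nat.Properties as ℕ
import Data.Nat.Divisibility as ℕ using (_∣_; _∣?_; ∣⇒≤; 1∣_)
import Data.Nat.DivMod as ℕ using (_%_; _/_; m≡m%n+[m/n]*n; m%n<n)
open import Data.Nat.Coprimality as Coprimality using (Coprime; coprime-Bézout)
open import Data.Nat.GCD using (module Bézout)
open import Data.Integer as ℤ using (_+_; -_; _⊖_; 0ℤ; 1ℤ)
import Data.Integer.Properties as ℤ
open import Data.Integer.Divisibility.Signed
  using (_∣_; divides; ∣ᵤ⇒∣; ∣⇒∣ᵤ; ∣-refl; ∣m+n∣m⇒∣n; ∣m∣n⇒∣m-n; ∣m⇒∣-m; ∣n⇒∣m*n)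
import Data.Integer.Coprimality as ℤ using (coprime-divisor)
open import Data.Integer.DivMod using (_%ℕ_; _/ℕ_; n%ℕd<d; a≡a%ℕn+[a/ℕn]*n)
open import Algebra.Properties.AbelianGroup ℤ.+-0-abelianGroup using (identityʳ-unique)
open import Data.Integer.Tactic.RingSolver using (solve-∀)
open import Data.List using ([]; _∷_; _++_; filter)
open import Data.List.Properties using (length-++; filter-++; filter-none; filter-some; filter-all)
open import Data.List.Membership.Propositional using (_∈_; _∉_; lose)
open import Data.List.Relation.Unary.Any using (here; there)
import Data.List.Relation.Unary.All as All
open import Data.List.Relation.Unary.All.Properties using (¬Any⇒All¬)
open import Data.List.Relation.Unary.AllPairs using ([]; _∷_)
open import Data.List.Membership.Propositional.Properties
  using (∈-filter⁺; ∈-filter⁻; ∈-++⁺ˡ; ∈-++⁺ʳ; ∈-++⁻)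
open import Data.List.Membership.DecPropositional ℤ._≟_ using (_∈?_; _∉?_)
open import Data.List.Membership.Propositional.Properties.WithK using (unique∧set⇒bag)
open import Data.List.Relation.Binary.BagAndSetEquality using (∼bag⇒↭)
open import Data.List.Relation.Binary.Permutation.Propositional using (_↭_)
open import Data.List.Relation.Binary.Permutation.Propositional.Properties
  using (↭-length; filter-↭)
import Data.List.Relation.Unary.Unique.Propositional.Properties as Unique
open import Data.Fin as Fin using (toℕ)
open import Data.Fin.Properties using (toℕ-fromℕ<; toℕ<n)
open import Data.Product using (Σ; ∃-syntax; _×_; _,_; proj₁; proj₂)
open import Data.Sum as Sum using (inj₁; inj₂)
open import Function.Base using (id; _∘_)
open import Function.Bundles using (mk⇔)
open import Relation.Nullary using (Dec; yes; no; ¬_)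
open import Relation.Binary.PropositionalEquality
  using (_≡_; _≢_; refl; sym; trans; cong; cong₂; subst; module ≡-Reasoning)

discrepancy : ℕ → List ℤ → ℤ
discrepancy d L = + d * + countDiv d L - + length L

module _ (d : ℕ) where

  countDiv-++ : ∀ xs ys → countDiv d (xs ++ ys) ≡ countDiv d xs ℕ.+ countDiv d ys
  countDiv-++ xs ys = trans (cong length (filter-++ _ xs ys)) (length-++ (filter _ xs))

  countDiv-↭ : ∀ {xs ys} → xs ↭ ys → countDiv d xs ≡ countDiv d ys
  countDiv-↭ p = ↭-length (filter-↭ _ p)

  discrepancy-++ : ∀ xs ys → discrepancy d (xs ++ ys) ≡ discrepancy d xs + discrepancy d ys
  discrepancy-++ xs ys = begin
    + d * + countDiv d (xs ++ ys) - + length (xs ++ ys)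
      ≡⟨ cong₂ (λ c l → + d * + c - + l) (countDiv-++ xs ys) (length-++ xs) ⟩
    + d * (+ countDiv d xs + + countDiv d ys) - (+ length xs + + length ys)
      ≡⟨ regroup (+ d) (+ countDiv d xs) (+ countDiv d ys) (+ length xs) (+ length ys) ⟩
    discrepancy d xs + discrepancy d ys ∎
    where
    open ≡-Reasoning
    regroup : ∀ a b c x y → a * (b + c) - (x + y) ≡ (a * b - x) + (a * c - y)
    regroup = solve-∀

  discrepancy-↭ : ∀ {xs ys} → xs ↭ ys → discrepancy d xs ≡ discrepancy d ys
  discrepancy-↭ p = cong₂ (λ c l → + d * + c - + l) (countDiv-↭ p) (↭-length p)

  countDiv-none : ∀ {xs} → (∀ {x} → x ∈ xs → ¬ + d ∣ x) → countDiv d xs ≡ 0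
  countDiv-none none =
    cong length (filter-none (λ x → d ℕ.∣? ∣ x ∣) (All.tabulate λ {x} x∈ → none x∈ ∘ ∣ᵤ⇒∣ {+ d} {x}))

  countDiv-some : ∀ {xs x} → x ∈ xs → + d ∣ x → 1 ≤ countDiv d xs
  countDiv-some x∈ d∣x = filter-some (λ x → d ℕ.∣? ∣ x ∣) (lose x∈ (∣⇒∣ᵤ d∣x))

  discrepancy-[] : discrepancy d [] ≡ 0ℤ
  discrepancy-[] = cong (_- 0ℤ) (ℤ.*-zeroʳ (+ d))

  ∣discrepancy∣≤ : ∀ xs → countDiv d xs ≤ 1 → length xs ≤ d → ∣ discrepancy d xs ∣ ≤ d
  ∣discrepancy∣≤ xs c≤1 l≤d = begin
    ∣ + d * + c - + l ∣    ≡⟨ cong (λ z → ∣ z - + l ∣) (ℤ.pos-* d c) ⟨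
    ∣ + (d ℕ.* c) - + l ∣  ≡⟨ cong ∣_∣ (ℤ.m-n≡m⊖n (d ℕ.* c) l) ⟩
    ∣ (d ℕ.* c) ⊖ l ∣      ≤⟨ ℤ.∣m⊝n∣≤m⊔n (d ℕ.* c) l ⟩
    d ℕ.* c ℕ.⊔ l          ≤⟨ ℕ.⊔-lub d*c≤d l≤d ⟩
    d                      ∎
    where
    open ℕ.≤-Reasoning
    c = countDiv d xs
    l = length xs
    d*c≤d : d ℕ.* c ≤ d
    d*c≤d = ℕ.≤-trans (ℕ.*-monoʳ-≤ d c≤1) (ℕ.≤-reflexive (ℕ.*-identityʳ d))

record Enumeration (S : ISet) : Set where
  field
    list   : List ℤ
    unique : Unique list
    exact  : S ≐ (_∈L list)

  complete : ∀ {x} → S x → x ∈ list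
  complete {x} = proj₁ (exact x)

  sound : ∀ {x} → x ∈ list → S x
  sound {x} = proj₂ (exact x)

open Enumeration

module _ {S : ISet} where

  enumeration-resp-≐ : ∀ {T} → S ≐ T → Enumeration T → Enumeration S
  enumeration-resp-≐ S≐T E = record
    { list   = list E
    ; unique = unique E
    ; exact  = λ x → (λ s → complete E (proj₁ (S≐T x) s)) , (λ l → proj₂ (S≐T x) (sound E l))
    }

  enumeration-dec : Enumeration S → ∀ x → Dec (S x)
  enumeration-dec E x with x ∈? list E
  ... | yes l = yes (sound E l)
  ... | no ¬l = no (λ s → ¬l (complete E s))

  enumeration-↭ : (E F : Enumeration S) → list E ↭ list F
  enumeration-↭ E F =
    ∼bag⇒↭ (unique∧set⇒bag (unique E) (unique F) (mk⇔ (complete F ∘ sound E) (complete E ∘ sound F)))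

module _ {S T : ISet} where

  enumeration-∪ : Disjoint S T → Enumeration S → Enumeration T → Enumeration (S ∪ T)
  enumeration-∪ disjoint E F = record
    { list   = list E ++ list F
    ; unique = Unique.++⁺ (unique E) (unique F) (λ (l , l′) → disjoint _ (sound E l) (sound F l′))
    ; exact  = λ x → Sum.[ ∈-++⁺ˡ ∘ complete E , ∈-++⁺ʳ (list E) ∘ complete F ]′
                   , Sum.map (sound E) (sound F) ∘ ∈-++⁻ (list E)
    }

  enumeration-∖ : Enumeration S → Enumeration T → Enumeration (S ∖ T)
  enumeration-∖ E F = record
    { list   = filter (_∉? list F) (list E)
    ; unique = Unique.filter⁺ (_∉? list F) (unique E)
    ; exact  = λ x → (λ (s , ¬t) → ∈-filter⁺ (_∉? list F) (complete E s) (¬t ∘ sound F))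
                   , (λ l → let (l₁ , ¬l₂) = ∈-filter⁻ (_∉? list F) l
                            in sound E l₁ , ¬l₂ ∘ complete F)
    }

  ∖-disjoint : Disjoint T (S ∖ T)
  ∖-disjoint x t (_ , ¬t) = ¬t t

  ⊆⇒≐∪∖ : (∀ x → Dec (T x)) → T ⊆ S → S ≐ (T ∪ (S ∖ T))
  ⊆⇒≐∪∖ T? T⊆S x = to , from
    where
    to : S x → (T ∪ (S ∖ T)) x
    to s with T? x
    ... | yes t = inj₁ t
    ... | no ¬t = inj₂ (s , ¬t)
    from : (T ∪ (S ∖ T)) x → S x
    from (inj₁ t)       = T⊆S x t
    from (inj₂ (s , _)) = s

discrepancy-∖ : ∀ d {S T} (E : Enumeration S) (F : Enumeration T) → T ⊆ S →
  discrepancy d (list (enumeration-∖ E F)) ≡ discrepancy d (list E) - discrepancy d (list F)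
discrepancy-∖ d E F T⊆S = begin
  δ                                   ≡⟨ y≡[x+y]-x δF δ ⟩
  (δF + δ) - δF                       ≡⟨ cong (_- δF) (discrepancy-++ d (list F) (list E∖F)) ⟨
  discrepancy d (list F ++ list E∖F) - δF
                                      ≡⟨ cong (_- δF) (discrepancy-↭ d (enumeration-↭ E E′)) ⟨
  discrepancy d (list E) - δF         ∎
  where
  open ≡-Reasoning
  E∖F = enumeration-∖ E F
  δ = discrepancy d (list E∖F)
  δF = discrepancy d (list F)
  E′ = enumeration-resp-≐ (⊆⇒≐∪∖ (enumeration-dec F) T⊆S) (enumeration-∪ ∖-disjoint F E∖F)
  y≡[x+y]-x : ∀ x y → y ≡ (x + y) - x
  y≡[x+y]-x = solve-∀

apList : ℤ → ℤ → ℕ → List ℤ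
apList a q zero    = []
apList a q (suc m) = a ∷ apList (a + q) q m

progression-zero : ∀ a q → a + 0ℤ * q ≡ a
progression-zero = solve-∀

progression-step : ∀ a q n → (a + q) + + n * q ≡ a + + suc n * q
progression-step a q n = shift a q (+ n)
  where
  shift : ∀ a q i → (a + q) + i * q ≡ a + (1ℤ + i) * q
  shift = solve-∀

length-apList : ∀ a q m → length (apList a q m) ≡ m
length-apList a q zero    = refl
length-apList a q (suc m) = cong suc (length-apList (a + q) q m)

apList-++ : ∀ a q m n → apList a q (m ℕ.+ n) ≡ apList a q m ++ apList (a + + m * q) q n
apList-++ a q zero    n = cong (λ b → apList b q n) (sym (progression-zero a q))
apList-++ a q (suc m) n =
  cong (a ∷_) (trans (apList-++ (a + q) q m n)
                     (cong (λ b → apList (a + q) q m ++ apList b q n) (progression-step a q m)))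

∈-apList⁻ : ∀ a q m {x} → x ∈ apList a q m → AP a q m x
∈-apList⁻ a q (suc m) (here x≡a)  = Fin.zero , trans x≡a (sym (progression-zero a q))
∈-apList⁻ a q (suc m) (there x∈) =
  let (i , x≡) = ∈-apList⁻ (a + q) q m x∈ in Fin.suc i , trans x≡ (progression-step a q (toℕ i))

∈-apList⁺ : ∀ a q m {x} → AP a q m x → x ∈ apList a q m
∈-apList⁺ a q (suc m) (Fin.zero  , x≡) = here (trans x≡ (progression-zero a q))
∈-apList⁺ a q (suc m) (Fin.suc i , x≡) =
  there (∈-apList⁺ (a + q) q m (i , trans x≡ (sym (progression-step a q (toℕ i)))))

discrepancy-apList-+ : ∀ d a q m n → discrepancy d (apList a q (m ℕ.+ n)) ≡
                       discrepancy d (apList a q m) + discrepancy d (apList (a + + m * q) q n)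
discrepancy-apList-+ d a q m n = trans (cong (discrepancy d) (apList-++ a q m n))
                                       (discrepancy-++ d (apList a q m) (apList (a + + m * q) q n))

apList-unique : ∀ a q m → q ≢ 0ℤ → Unique (apList a q m)
apList-unique a q zero    q≢0 = []
apList-unique a q (suc m) q≢0 = ¬Any⇒All¬ _ a∉ ∷ apList-unique (a + q) q m q≢0
  where
  a∉ : a ∉ apList (a + q) q m
  a∉ a∈ with (i , a≡) ← ∈-apList⁻ (a + q) q m a∈ = q≢0 (ℤ.*-cancelˡ-≡ (+ suc (toℕ i)) q 0ℤ (begin
    + suc (toℕ i) * q  ≡⟨ identityʳ-unique a _ (sym (trans a≡ (progression-step a q (toℕ i)))) ⟩
    0ℤ                 ≡⟨ ℤ.*-zeroʳ (+ suc (toℕ i)) ⟨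
    + suc (toℕ i) * 0ℤ ∎))
    where open ≡-Reasoning

apEnumeration : ∀ a q m → q ≢ 0ℤ → Enumeration (AP a q m)
apEnumeration a q m q≢0 = record
  { list   = apList a q m
  ; unique = apList-unique a q m q≢0
  ; exact  = λ _ → ∈-apList⁺ a q m , ∈-apList⁻ a q m
  }

module _ {d : ℕ} {q : ℤ} (coprime : Coprime ∣ q ∣ d) where

  inverse-of-∣q∣ : ∃[ u ] + d ∣ u * + ∣ q ∣ - 1ℤ
  inverse-of-∣q∣ with coprime-Bézout coprime
  ... | Bézout.+- x y 1+yd≡xq = + x , divides (+ y) (begin
    + x * + ∣ q ∣ - 1ℤ     ≡⟨ cong (_- 1ℤ) (ℤ.pos-* x ∣ q ∣) ⟨
    + (x ℕ.* ∣ q ∣) - 1ℤ   ≡⟨ cong (λ n → + n - 1ℤ) 1+yd≡xq ⟨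
    1ℤ + + (y ℕ.* d) - 1ℤ  ≡⟨ [1+a]-1≡a (+ (y ℕ.* d)) ⟩
    + (y ℕ.* d)            ≡⟨ ℤ.pos-* y d ⟩
    + y * + d              ∎)
    where
    open ≡-Reasoning
    [1+a]-1≡a : ∀ a → 1ℤ + a - 1ℤ ≡ a
    [1+a]-1≡a = solve-∀
  ... | Bézout.-+ x y 1+xq≡yd = - + x , divides (- + y) (begin
    - + x * + ∣ q ∣ - 1ℤ     ≡⟨ [-a]*b-1≡-[1+a*b] (+ x) (+ ∣ q ∣) ⟩
    - (1ℤ + + x * + ∣ q ∣)   ≡⟨ cong (λ z → - (1ℤ + z)) (ℤ.pos-* x ∣ q ∣) ⟨
    - + (1 ℕ.+ x ℕ.* ∣ q ∣)  ≡⟨ cong (λ n → - + n) 1+xq≡yd ⟩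
    - + (y ℕ.* d)            ≡⟨ cong -_ (ℤ.pos-* y d) ⟩
    - (+ y * + d)            ≡⟨ ℤ.neg-distribˡ-* (+ y) (+ d) ⟩
    - + y * + d              ∎)
    where
    open ≡-Reasoning
    [-a]*b-1≡-[1+a*b] : ∀ a b → - a * b - 1ℤ ≡ - (1ℤ + a * b)
    [-a]*b-1≡-[1+a*b] = solve-∀

  modular-inverse : ∃[ u ] + d ∣ u * q - 1ℤ
  modular-inverse with (u , d∣) ← inverse-of-∣q∣ | ℤ.+∣i∣≡i⊎+∣i∣≡-i q
  ... | inj₁ ∣q∣≡q  = u , subst (λ z → + d ∣ u * z - 1ℤ) ∣q∣≡q d∣
  ... | inj₂ ∣q∣≡-q =
    - u , subst (+ d ∣_) (a*[-b]≡[-a]*b u q) (subst (λ z → + d ∣ u * z - 1ℤ) ∣q∣≡-q d∣)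
    where
    a*[-b]≡[-a]*b : ∀ a b → a * (- b) - 1ℤ ≡ (- a) * b - 1ℤ
    a*[-b]≡[-a]*b = solve-∀

  ∣-step⇒∣-index : ∀ {b} j → + d ∣ b → + d ∣ b + + j * q → d ℕ.∣ j
  ∣-step⇒∣-index j d∣b d∣b+jq = ℤ.coprime-divisor (+ d) q (+ j) (Coprimality.sym coprime)
    (∣⇒∣ᵤ (subst (+ d ∣_) (ℤ.*-comm (+ j) q) (∣m+n∣m⇒∣n d∣b+jq d∣b)))

  module _ .{{_ : NonZero d}} where

    -- With u·q ≡ 1 (mod d), the index r ≡ −b·u (mod d) gives b + r·q ≡ b − b·u·q ≡ 0 (mod d).
    ∃-multiple-in-window : ∀ b → ∃[ x ] AP b q d x × + d ∣ x
    ∃-multiple-in-window b =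
      b + + r * q , (Fin.fromℕ< r<d , cong (λ i → b + + i * q) (sym (toℕ-fromℕ< r<d))) , d∣b+rq
      where
      u = proj₁ modular-inverse
      n = - (b * u)
      r = n %ℕ d
      t = n /ℕ d
      r<d = n%ℕd<d n d
      b+rq≡ : b + + r * q ≡ - (b * (u * q - 1ℤ)) - (t * q) * + d
      b+rq≡ = begin
        b + + r * q
          ≡⟨ add-and-subtract b (+ r) t q (+ d) ⟩
        b + (+ r + t * + d) * q - (t * q) * + d
          ≡⟨ cong (λ z → b + z * q - (t * q) * + d) (a≡a%ℕn+[a/ℕn]*n n d) ⟨
        b + n * q - (t * q) * + d
          ≡⟨ regroup b u t q (+ d) ⟩
        - (b * (u * q - 1ℤ)) - (t * q) * + d ∎
        where
        open ≡-Reasoning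
        add-and-subtract : ∀ b r t q D → b + r * q ≡ b + (r + t * D) * q - (t * q) * D
        add-and-subtract = solve-∀
        regroup : ∀ b u t q D →
                  b + (- (b * u)) * q - (t * q) * D ≡ - (b * (u * q - 1ℤ)) - (t * q) * D
        regroup = solve-∀
      d∣b+rq : + d ∣ b + + r * q
      d∣b+rq = subst (+ d ∣_) (sym b+rq≡)
        (∣m∣n⇒∣m-n (∣m⇒∣-m (∣n⇒∣m*n b (proj₂ modular-inverse))) (∣n⇒∣m*n (t * q) (∣-refl {+ d})))

    countDiv-apList≤1 : ∀ r b → r ≤ d → countDiv d (apList b q r) ≤ 1
    countDiv-apList≤1 zero    b _   = z≤n
    countDiv-apList≤1 (suc r) b r<d with d ℕ.∣? ∣ b ∣
    ... | yes d∣b = s≤s (ℕ.≤-reflexive (countDiv-none d no-later-multiple))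
      where
      no-later-multiple : ∀ {x} → x ∈ apList (b + q) q r → ¬ + d ∣ x
      no-later-multiple x∈ d∣x with (i , x≡) ← ∈-apList⁻ (b + q) q r x∈ =
        ℕ.<⇒≱ (ℕ.<-≤-trans (s≤s (toℕ<n i)) r<d) (ℕ.∣⇒≤ d∣1+i)
        where
        d∣1+i : d ℕ.∣ suc (toℕ i)
        d∣1+i = ∣-step⇒∣-index (suc (toℕ i)) (∣ᵤ⇒∣ {+ d} {b} d∣b)
                  (subst (+ d ∣_) (trans x≡ (progression-step b q (toℕ i))) d∣x)
    ... | no _ = countDiv-apList≤1 r (b + q) (ℕ.<⇒≤ r<d)

    countDiv-window : ∀ b → countDiv d (apList b q d) ≡ 1
    countDiv-window b =
      ℕ.≤-antisym (countDiv-apList≤1 d b ℕ.≤-refl) (multiple⇒1≤countDiv (∃-multiple-in-window b))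
      where
      multiple⇒1≤countDiv : (∃[ x ] AP b q d x × + d ∣ x) → 1 ≤ countDiv d (apList b q d)
      multiple⇒1≤countDiv (x , x∈AP , d∣x) = countDiv-some d (∈-apList⁺ b q d x∈AP) d∣x

    discrepancy-window : ∀ b → discrepancy d (apList b q d) ≡ 0ℤ
    discrepancy-window b = begin
      + d * + countDiv d (apList b q d) - + length (apList b q d)
        ≡⟨ cong₂ (λ c l → + d * + c - + l) (countDiv-window b) (length-apList b q d) ⟩
      + d * 1ℤ - + d  ≡⟨ cong (_- + d) (ℤ.*-identityʳ (+ d)) ⟩
      + d - + d       ≡⟨ ℤ.+-inverseʳ (+ d) ⟩
      0ℤ              ∎
      where open ≡-Reasoning

    discrepancy-windows : ∀ t b → discrepancy d (apList b q (t ℕ.* d)) ≡ 0ℤ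
    discrepancy-windows zero    b = discrepancy-[] d
    discrepancy-windows (suc t) b = begin
      discrepancy d (apList b q (d ℕ.+ t ℕ.* d))
        ≡⟨ discrepancy-apList-+ d b q d (t ℕ.* d) ⟩
      discrepancy d (apList b q d) + discrepancy d (apList (b + + d * q) q (t ℕ.* d))
        ≡⟨ cong₂ _+_ (discrepancy-window b) (discrepancy-windows t (b + + d * q)) ⟩
      0ℤ ∎
      where open ≡-Reasoning

    ∣discrepancy-apList∣≤ : ∀ m b → ∣ discrepancy d (apList b q m) ∣ ≤ d
    ∣discrepancy-apList∣≤ m b = begin
      ∣ discrepancy d (apList b q m) ∣
        ≡⟨ cong (λ n → ∣ discrepancy d (apList b q n) ∣) (ℕ.m≡m%n+[m/n]*n m d) ⟩
      ∣ discrepancy d (apList b q (r ℕ.+ t ℕ.* d)) ∣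
        ≡⟨ cong ∣_∣ (discrepancy-apList-+ d b q r (t ℕ.* d)) ⟩
      ∣ δ + discrepancy d (apList (b + + r * q) q (t ℕ.* d)) ∣
        ≡⟨ cong (λ z → ∣ δ + z ∣) (discrepancy-windows t (b + + r * q)) ⟩
      ∣ δ + 0ℤ ∣
        ≡⟨ cong ∣_∣ (ℤ.+-identityʳ δ) ⟩
      ∣ δ ∣
        ≤⟨ ∣discrepancy∣≤ d (apList b q r) (countDiv-apList≤1 r b r≤d) length≤d ⟩
      d ∎
      where
      open ℕ.≤-Reasoning
      r = m ℕ.% d
      t = m ℕ./ d
      δ = discrepancy d (apList b q r)
      r≤d = ℕ.<⇒≤ (ℕ.m%n<n m d)
      length≤d = ℕ.≤-trans (ℕ.≤-reflexive (length-apList b q r)) r≤d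

discrepancy-1 : ∀ L → discrepancy 1 L ≡ 0ℤ
discrepancy-1 L = begin
  + 1 * + countDiv 1 L - + length L  ≡⟨ cong (λ c → + 1 * + c - + length L) countDiv-1 ⟩
  + 1 * + length L - + length L      ≡⟨ cong (_- + length L) (ℤ.*-identityˡ (+ length L)) ⟩
  + length L - + length L            ≡⟨ ℤ.+-inverseʳ (+ length L) ⟩
  0ℤ                                 ∎
  where
  open ≡-Reasoning
  countDiv-1 : countDiv 1 L ≡ length L
  countDiv-1 = cong length (filter-all (λ x → 1 ℕ.∣? ∣ x ∣) (All.universal (λ x → ℕ.1∣ ∣ x ∣) L))

m+n≤[k₁+k₂]*d : ∀ k₁ k₂ d {m n} → m ≤ k₁ ℕ.* d → n ≤ k₂ ℕ.* d → m ℕ.+ n ≤ (k₁ ℕ.+ k₂) ℕ.* d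
m+n≤[k₁+k₂]*d k₁ k₂ d m≤ n≤ =
  ℕ.≤-trans (ℕ.+-mono-≤ m≤ n≤) (ℕ.≤-reflexive (sym (ℕ.*-distribʳ-+ d k₁ k₂)))

-- Only for d ≥ 2 does coprimality force q ≢ 0, i.e. make the progression lists duplicate-free;
-- d = 1 is covered by discrepancy-1.
module _ {d : ℕ} .{{_ : NonTrivial d}} where

  private instance
    d≢0 : NonZero d
    d≢0 = ℕ.nonTrivial⇒nonZero d

  enumerate : ∀ {k S} → APComb d k S → Σ (Enumeration S) λ E → ∣ discrepancy d (list E) ∣ ≤ k ℕ.* d
  enumerate (ap a q m coprime S≐AP) =
    enumeration-resp-≐ S≐AP (apEnumeration a q m q≢0) ,
    ℕ.≤-trans (∣discrepancy-apList∣≤ coprime m a) (ℕ.≤-reflexive (sym (ℕ.*-identityˡ d)))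
    where
    q≢0 : q ≢ 0ℤ
    q≢0 refl = Coprimality.¬0-coprimeTo-2+ coprime
  enumerate (union {k₁ = k₁} {k₂} c₁ c₂ disjoint S≐S₁∪S₂)
    with (E₁ , bound₁) ← enumerate c₁ | (E₂ , bound₂) ← enumerate c₂ =
    enumeration-resp-≐ S≐S₁∪S₂ (enumeration-∪ disjoint E₁ E₂) ,
    (begin
      ∣ discrepancy d (list E₁ ++ list E₂) ∣
        ≡⟨ cong ∣_∣ (discrepancy-++ d (list E₁) (list E₂)) ⟩
      ∣ discrepancy d (list E₁) + discrepancy d (list E₂) ∣
        ≤⟨ ℤ.∣i+j∣≤∣i∣+∣j∣ (discrepancy d (list E₁)) (discrepancy d (list E₂)) ⟩
      ∣ discrepancy d (list E₁) ∣ ℕ.+ ∣ discrepancy d (list E₂) ∣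
        ≤⟨ m+n≤[k₁+k₂]*d k₁ k₂ d bound₁ bound₂ ⟩
      _ ∎)
    where open ℕ.≤-Reasoning
  enumerate (diff {k₁ = k₁} {k₂} c₁ c₂ S₂⊆S₁ S≐S₁∖S₂)
    with (E₁ , bound₁) ← enumerate c₁ | (E₂ , bound₂) ← enumerate c₂ =
    enumeration-resp-≐ S≐S₁∖S₂ (enumeration-∖ E₁ E₂) ,
    (begin
      ∣ discrepancy d (list (enumeration-∖ E₁ E₂)) ∣
        ≡⟨ cong ∣_∣ (discrepancy-∖ d E₁ E₂ S₂⊆S₁) ⟩
      ∣ discrepancy d (list E₁) - discrepancy d (list E₂) ∣
        ≤⟨ ℤ.∣i-j∣≤∣i∣+∣j∣ (discrepancy d (list E₁)) (discrepancy d (list E₂)) ⟩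
      ∣ discrepancy d (list E₁) ∣ ℕ.+ ∣ discrepancy d (list E₂) ∣
        ≤⟨ m+n≤[k₁+k₂]*d k₁ k₂ d bound₁ bound₂ ⟩
      _ ∎)
    where open ℕ.≤-Reasoning

lemma3p4 : (k d : ℕ) → 1 ≤ k → 1 ≤ d → (L : List ℤ) → Unique L →
    APComb d k (λ x → x ∈L L) →
    ∣ (+ d) * (+ countDiv d L) - (+ length L) ∣ ≤ k Data.Nat.* d
lemma3p4 k (suc zero) _ _ L _ _ = subst (λ δ → ∣ δ ∣ ≤ k ℕ.* 1) (sym (discrepancy-1 L)) z≤n
lemma3p4 k d@(suc (suc _)) _ _ L L-unique comb with (E , bound) ← enumerate comb =
  subst (λ δ → ∣ δ ∣ ≤ k ℕ.* d) (sym (discrepancy-↭ d (enumeration-↭ L-enumeration E))) bound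
  where
  L-enumeration : Enumeration (_∈L L)
  L-enumeration = record { list = L ; unique = L-unique ; exact = λ _ → id , id }
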